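{- Let $\mathbb{L}=(L,\vee,\wedge,{\sim},{^*},0,1)$ be a regular pseudocomplemented Kleene algebra, let $\mathcal{F}_p$ be its set of prime filters, and let $g(P)=\{x\in L\mid {\sim}x\notin P\}$ for $P\in\mathcal{F}_p$. Let $\mathcal{U}(\mathcal{F}_p)$ be the family of $\subseteq$-upward-closed subsets of $\mathcal{F}_p$ with ${\sim}A=\{P\mid g(P)\notin A\}$ and $A^*=\{P\mid {\uparrow}P\cap A=\emptyset\}$, where ${\uparrow}P=\{Q\in\mathcal{F}_p\mid P\subseteq Q\}$. The following are equivalent: (a) $\mathbb{L}$ satisfies $x^*\vee x^{**}=1$ for all $x\in L$; (b) $(\mathcal{F}_p,\subseteq)$ is a union of disjoint chains of at most two elements; (c) the algebra $(\mathcal{U}(\mathcal{F}_p),\cup,\cap,{\sim},{^*},\emptyset,\mathcal{F}_p)$ satisfies the Stone identity $A^*\cup A^{**}=\mathcal{F}_p$ for all $A\in\mathcal{U}(\mathcal{F}_p)$.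
   Context: A pseudocomplemented Kleene algebra is an algebra $(L,\vee,\wedge,{\sim},{^*},0,1)$ such that $(L,\vee,\wedge,0,1)$ is a bounded distributive lattice, ${\sim}{\sim}x=x$, $x\leq y\Rightarrow{\sim}x\geq{\sim}y$, $x\wedge{\sim}x\leq y\vee{\sim}y$, and ${^*}$ is the pseudocomplement ($x\wedge z=0$ iff $z\leq x^*$); it is regular if $x^*=y^*$ and $({\sim}x)^*=({\sim}y)^*$ imply $x=y$. A prime filter is a filter $P\neq L$ such that $a\vee b\in P$ implies $a\in P$ or $b\in P$. "Union of disjoint chains of at most two elements" means the set can be partitioned into chains of at most two elements such that elements of different blocks are incomparable. -}

module Defs where

open import Level using (0ℓ) renaming (suc to lsuc)
open import Data.Product using (Σ; Σ-syntax; _×_; _,_; proj₁)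
open import Data.Empty using (⊥)
open import Relation.Binary.Structures using (IsEquivalence)
open import Data.Sum using (_⊎_)
open import Relation.Nullary using (¬_)
open import Relation.Binary.PropositionalEquality using (_≡_)
open import Algebra.Lattice.Structures using (IsDistributiveLattice)
open import Function.Bundles using (_⇔_)

record PKA : Set₁ where
  infixr 6 _∨_
  infixr 7 _∧_
  infix 8 ∼_
  infix 4 _≤_
  field
    Carrier : Set
    _∨_ _∧_ : Carrier → Carrier → Carrier
    ∼_ _* : Carrier → Carrier
    𝟘 𝟙 : Carrier
    isDistributiveLattice : IsDistributiveLattice _≡_ _∨_ _∧_
    𝟘-bottom : ∀ x → 𝟘 ∨ x ≡ x
    𝟙-top    : ∀ x → 𝟙 ∧ x ≡ x

  _≤_ : Carrier → Carrier → Set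
  x ≤ y = x ∧ y ≡ x

  field
    ∼-involutive : ∀ x → ∼ (∼ x) ≡ x
    ∼-antitone   : ∀ {x y} → x ≤ y → ∼ y ≤ ∼ x
    kleene       : ∀ x y → (x ∧ ∼ x) ≤ (y ∨ ∼ y)
    pseudocomplement : ∀ x z → (x ∧ z ≡ 𝟘) ⇔ (z ≤ (x *))

Regular : PKA → Set
Regular 𝕃 = ∀ x y → x * ≡ y * → (∼ x) * ≡ (∼ y) * → x ≡ y
  where open PKA 𝕃

module _ (𝕃 : PKA) where
  open PKA 𝕃

  Subset : Set₁
  Subset = Carrier → Set

  _⊆_ : Subset → Subset → Set
  S ⊆ T = ∀ x → S x → T x

  IsFilter : Subset → Set
  IsFilter F = F 𝟙
             × (∀ x y → F x → x ≤ y → F y)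
             × (∀ x y → F x → F y → F (x ∧ y))

  IsIdeal : Subset → Set
  IsIdeal I = I 𝟘
            × (∀ x y → I y → x ≤ y → I x)
            × (∀ x y → I x → I y → I (x ∨ y))

  IsPrimeFilter : Subset → Set
  IsPrimeFilter P = IsFilter P
                  × ¬ (∀ x → P x)
                  × (∀ a b → P (a ∨ b) → P a ⊎ P b)

  PrimeFilter : Set₁
  PrimeFilter = Σ Subset IsPrimeFilter

  _⊑_ : PrimeFilter → PrimeFilter → Set
  (P , _) ⊑ (Q , _) = P ⊆ Q

  _≐_ : PrimeFilter → PrimeFilter → Set
  P ≐ Q = (P ⊑ Q) × (Q ⊑ P)

  -- Prime filter theorem (a consequence of the axiom of choice), used as
  -- a hypothesis: a filter disjoint from an ideal extends to a prime
  -- filter disjoint from that ideal.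
  PrimeFilterTheorem : Set₁
  PrimeFilterTheorem =
    ∀ (F I : Subset) → IsFilter F → IsIdeal I → (∀ x → F x → I x → ⊥) →
      Σ[ P ∈ PrimeFilter ] ((F ⊆ proj₁ P) × (∀ x → proj₁ P x → ¬ I x))

  g : PrimeFilter → Subset
  g P x = ¬ proj₁ P (∼ x)

  IsUpset : (PrimeFilter → Set₁) → Set₁
  IsUpset A = ∀ P Q → P ⊑ Q → A P → A Q

  ∼ᵁ : (PrimeFilter → Set₁) → (PrimeFilter → Set₁)
  ∼ᵁ A P = ¬ (Σ[ Q ∈ PrimeFilter ] ((proj₁ Q ⊆ g P) × (g P ⊆ proj₁ Q) × A Q))

  _*ᵁ : (PrimeFilter → Set₁) → (PrimeFilter → Set₁)
  (A *ᵁ) P = ¬ (Σ[ Q ∈ PrimeFilter ] ((P ⊑ Q) × A Q))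

  StoneL : Set
  StoneL = ∀ x → (x *) ∨ ((x *) *) ≡ 𝟙

  -- (b) (𝓕p, ⊆) is a union of disjoint chains of at most two elements:
  -- there is a partition (an equivalence relation B) whose blocks are
  -- chains with at most two elements, and elements of different blocks
  -- are incomparable.
  TwoChainUnion : Set₁
  TwoChainUnion =
    Σ[ B ∈ (PrimeFilter → PrimeFilter → Set) ]
      ( IsEquivalence B
      × (∀ P Q → B P Q → (P ⊑ Q) ⊎ (Q ⊑ P))
      × (∀ P Q R → B P Q → B P R → B Q R → (P ≐ Q) ⊎ ((P ≐ R) ⊎ (Q ≐ R)))
      × (∀ P Q → P ⊑ Q → B P Q) )

  StoneU : Set₂
  StoneU = ∀ (A : PrimeFilter → Set₁) → IsUpset A →
             ∀ P → (A *ᵁ) P ⊎ ((A *ᵁ) *ᵁ) P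

module Submission where

-- After the order theory of 𝕃 (lattice order, De Morgan laws, dense elements)
-- the key algebraic fact is a consequence of regularity: x ∧ ∼(∼x)* ≤ y ∨ y*.
-- It forbids strict chains P ⊂ Q ⊂ R of prime filters.  The prime filter
-- g(P) = {x | ∼x ∉ P} reverses inclusion, dualising "above" and "below".
--   (a) ⇒ (b): primes above a common prime are comparable (otherwise the prime
--     filter theorem yields a strict 3-chain), dually below; so comparability
--     is an equivalence relation whose blocks are chains of length ≤ 2.
--   (b) ⇒ (c): if ↑P meets an upset A, then ↑P misses A*.
--   (c) ⇒ (a): a prime filter avoiding x* ∨ x** violates the Stone identity
--     for the upset of the prime filters containing x.

open import Defs renaming (_⊑_ to Included; _≐_ to SameFilter)
open import Level using (0ℓ; Lift; lift) renaming (suc to lsuc)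
open import Data.Product using (_×_; ∃; _,_; proj₁; proj₂; swap)
open import Data.Sum using (_⊎_; inj₁; inj₂; [_,_]′)
open import Data.Empty using (⊥; ⊥-elim)
open import Function.Base using (_∘_; id)
open import Function.Bundles using (_⇔_; mk⇔; Equivalence)
open import Axiom.ExcludedMiddle using (ExcludedMiddle)
open import Axiom.DoubleNegationElimination using (em⇒dne)
open import Relation.Nullary using (¬_; yes; no)
open import Relation.Binary.PropositionalEquality
  using (_≡_; _≢_; refl; sym; trans; cong; cong₂; subst; module ≡-Reasoning)
open import Relation.Binary.Structures using (IsEquivalence)
open import Algebra.Lattice.Bundles using (Lattice)
open import Algebra.Lattice.Structures using (IsDistributiveLattice)
import Algebra.Lattice.Properties.Lattice as LatticeProperties
import Relation.Binary.Lattice.Bundles as OrderTheoretic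

module _ (𝕃 : PKA) where
  open PKA 𝕃
  open IsDistributiveLattice isDistributiveLattice
    using (isLattice; ∧-comm; ∧-assoc; ∧-absorbs-∨)
  open ≡-Reasoning

  -- The order-theoretic lattice of 𝕃 from the library; its order is
  -- x ≡ x ∧ y, the symmetric reading of our x ≤ y.
  private
    lattice : Lattice 0ℓ 0ℓ
    lattice = record
      { Carrier = Carrier ; _≈_ = _≡_ ; _∨_ = _∨_ ; _∧_ = _∧_ ; isLattice = isLattice }
    module O = OrderTheoretic.Lattice
      (LatticeProperties.∨-∧-orderTheoreticLattice lattice)

  ≤-refl : ∀ {x} → x ≤ x
  ≤-refl = sym O.refl

  ≤-trans : ∀ {x y z} → x ≤ y → y ≤ z → x ≤ z
  ≤-trans p q = sym (O.trans (sym p) (sym q))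

  ≤-antisym : ∀ {x y} → x ≤ y → y ≤ x → x ≡ y
  ≤-antisym p q = O.antisym (sym p) (sym q)

  ∧-lowerˡ : ∀ x y → x ∧ y ≤ x
  ∧-lowerˡ x y = sym (O.x∧y≤x x y)

  ∧-lowerʳ : ∀ x y → x ∧ y ≤ y
  ∧-lowerʳ x y = sym (O.x∧y≤y x y)

  ∧-greatest : ∀ {x y z} → x ≤ y → x ≤ z → x ≤ y ∧ z
  ∧-greatest p q = sym (O.∧-greatest (sym p) (sym q))

  ∨-upperˡ : ∀ x y → x ≤ x ∨ y
  ∨-upperˡ x y = sym (O.x≤x∨y x y)

  ∨-upperʳ : ∀ x y → y ≤ x ∨ y
  ∨-upperʳ x y = sym (O.y≤x∨y x y)

  ∨-least : ∀ {x y z} → x ≤ z → y ≤ z → x ∨ y ≤ z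
  ∨-least p q = sym (O.∨-least (sym p) (sym q))

  ∧-monoˡ : ∀ {x y} z → x ≤ y → x ∧ z ≤ y ∧ z
  ∧-monoˡ {x} z p = ∧-greatest (≤-trans (∧-lowerˡ x z) p) (∧-lowerʳ x z)

  𝟘-least : ∀ x → 𝟘 ≤ x
  𝟘-least x = trans (cong (𝟘 ∧_) (sym (𝟘-bottom x))) (∧-absorbs-∨ 𝟘 x)

  𝟙-greatest : ∀ x → x ≤ 𝟙
  𝟙-greatest x = trans (∧-comm x 𝟙) (𝟙-top x)

  ≤𝟘⇒≡𝟘 : ∀ {x} → x ≤ 𝟘 → x ≡ 𝟘
  ≤𝟘⇒≡𝟘 p = ≤-antisym p (𝟘-least _)

  𝟙≤⇒≡𝟙 : ∀ {x} → 𝟙 ≤ x → x ≡ 𝟙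
  𝟙≤⇒≡𝟙 p = ≤-antisym (𝟙-greatest _) p

  ∼-reverse : ∀ {x y} → ∼ x ≤ y → ∼ y ≤ x
  ∼-reverse {x} {y} p = subst (∼ y ≤_) (∼-involutive x) (∼-antitone p)

  ∼𝟙 : ∼ 𝟙 ≡ 𝟘
  ∼𝟙 = ≤𝟘⇒≡𝟘 (∼-reverse (𝟙-greatest (∼ 𝟘)))

  ∼𝟘 : ∼ 𝟘 ≡ 𝟙
  ∼𝟘 = trans (cong ∼_ (sym ∼𝟙)) (∼-involutive 𝟙)

  ∼-∧ : ∀ x y → ∼ (x ∧ y) ≡ ∼ x ∨ ∼ y
  ∼-∧ x y = ≤-antisym
    (∼-reverse (∧-greatest (∼-reverse (∨-upperˡ (∼ x) (∼ y)))
                           (∼-reverse (∨-upperʳ (∼ x) (∼ y)))))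
    (∨-least (∼-antitone (∧-lowerˡ x y)) (∼-antitone (∧-lowerʳ x y)))

  ∼-∨ : ∀ x y → ∼ (x ∨ y) ≡ ∼ x ∧ ∼ y
  ∼-∨ x y = begin
    ∼ (x ∨ y)                   ≡⟨ cong ∼_ (cong₂ _∨_ (sym (∼-involutive x)) (sym (∼-involutive y))) ⟩
    ∼ (∼ (∼ x) ∨ ∼ (∼ y))       ≡⟨ cong ∼_ (sym (∼-∧ (∼ x) (∼ y))) ⟩
    ∼ (∼ (∼ x ∧ ∼ y))           ≡⟨ ∼-involutive _ ⟩
    ∼ x ∧ ∼ y                   ∎

  *-greatest : ∀ {x z} → x ∧ z ≡ 𝟘 → z ≤ x *
  *-greatest {x} {z} = Equivalence.to (pseudocomplement x z)

  ∧-* : ∀ x → x ∧ x * ≡ 𝟘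
  ∧-* x = Equivalence.from (pseudocomplement x (x *)) ≤-refl

  *-antitone : ∀ {x y} → x ≤ y → y * ≤ x *
  *-antitone {x} {y} p = *-greatest (begin
    x ∧ y *         ≡⟨ cong (_∧ y *) (sym p) ⟩
    (x ∧ y) ∧ y *   ≡⟨ ∧-assoc x y (y *) ⟩
    x ∧ (y ∧ y *)   ≡⟨ cong (x ∧_) (∧-* y) ⟩
    x ∧ 𝟘           ≡⟨ ∧-comm x 𝟘 ⟩
    𝟘 ∧ x           ≡⟨ 𝟘-least x ⟩
    𝟘               ∎)

  ∨*-dense : ∀ y → (y ∨ y *) * ≡ 𝟘
  ∨*-dense y = ≤𝟘⇒≡𝟘 (subst ((y ∨ y *) * ≤_) (∧-* (y *))
    (∧-greatest (*-antitone (∨-upperˡ y (y *))) (*-antitone (∨-upperʳ y (y *)))))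

  dense-upward : ∀ {d e} → d * ≡ 𝟘 → d ≤ e → e * ≡ 𝟘
  dense-upward {d} {e} d-dense d≤e = ≤𝟘⇒≡𝟘 (subst (e * ≤_) d-dense (*-antitone d≤e))

  dense-meet : ∀ {d} v → d * ≡ 𝟘 → (v ∧ d) * ≡ v *
  dense-meet {d} v d-dense =
    ≤-antisym (*-greatest (trans (∧-comm v w) w∧v≡𝟘)) (*-antitone (∧-lowerˡ v d))
    where
    w = (v ∧ d) *
    w∧v≡𝟘 : w ∧ v ≡ 𝟘
    w∧v≡𝟘 = ≤𝟘⇒≡𝟘 (subst (w ∧ v ≤_) d-dense (*-greatest (begin
      d ∧ (w ∧ v)   ≡⟨ cong (d ∧_) (∧-comm w v) ⟩
      d ∧ (v ∧ w)   ≡⟨ sym (∧-assoc d v w) ⟩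
      (d ∧ v) ∧ w   ≡⟨ cong (_∧ w) (∧-comm d v) ⟩
      (v ∧ d) ∧ w   ≡⟨ ∧-* (v ∧ d) ⟩
      𝟘             ∎)))

  ∼*-cover : ∀ x → x ∨ ∼ ((∼ x) *) ≡ 𝟙
  ∼*-cover x = begin
    x ∨ ∼ ((∼ x) *)           ≡⟨ cong (_∨ ∼ ((∼ x) *)) (sym (∼-involutive x)) ⟩
    ∼ (∼ x) ∨ ∼ ((∼ x) *)     ≡⟨ sym (∼-∧ (∼ x) ((∼ x) *)) ⟩
    ∼ (∼ x ∧ (∼ x) *)         ≡⟨ cong ∼_ (∧-* (∼ x)) ⟩
    ∼ 𝟘                       ≡⟨ ∼𝟘 ⟩
    𝟙                         ∎

  -- For v = x ∧ ∼(∼x)* and the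
  -- dense d = y ∨ y*, both v ∧ d and v have the same * (d is dense) and the
  -- same ∼-* (∼v = ∼x ∨ (∼x)* is dense), so v ∧ d = v, i.e. v ≤ d.
  regular-bound : Regular 𝕃 → ∀ x y → x ∧ ∼ ((∼ x) *) ≤ y ∨ y *
  regular-bound regular x y =
    regular (v ∧ d) v (dense-meet v (∨*-dense y)) (trans ∼[v∧d]-dense (sym ∼v-dense))
    where
    v = x ∧ ∼ ((∼ x) *)
    d = y ∨ y *
    ∼v-dense : (∼ v) * ≡ 𝟘
    ∼v-dense = trans (cong _* (trans (∼-∧ x _) (cong (∼ x ∨_) (∼-involutive _))))
                     (∨*-dense (∼ x))
    ∼[v∧d]-dense : (∼ (v ∧ d)) * ≡ 𝟘
    ∼[v∧d]-dense = dense-upward ∼v-dense (∼-antitone (∧-lowerˡ v d))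

  PF : Set₁
  PF = PrimeFilter 𝕃

  infix 4 _∈_ _∉_ _⊑_ _≐_ _⊈_ _⊏_

  _∈_ : Carrier → PF → Set
  x ∈ P = proj₁ P x

  _∉_ : Carrier → PF → Set
  x ∉ P = ¬ x ∈ P

  _⊑_ : PF → PF → Set
  P ⊑ Q = Included 𝕃 P Q

  _≐_ : PF → PF → Set
  P ≐ Q = SameFilter 𝕃 P Q

  _⊈_ : PF → PF → Set
  P ⊈ Q = ∃ λ x → x ∈ P × x ∉ Q

  _⊏_ : PF → PF → Set
  P ⊏ Q = P ⊑ Q × Q ⊈ P

  Comparable : PF → PF → Set
  Comparable P Q = P ⊑ Q ⊎ Q ⊑ P

  Incomparable : PF → PF → Set
  Incomparable P Q = P ⊈ Q × Q ⊈ P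

  module _ (P : PF) where
    𝟙∈ : 𝟙 ∈ P
    𝟙∈ = proj₁ (proj₁ (proj₂ P))

    ∈-upward : ∀ {x y} → x ∈ P → x ≤ y → y ∈ P
    ∈-upward = proj₁ (proj₂ (proj₁ (proj₂ P))) _ _

    ∧-∈ : ∀ {x y} → x ∈ P → y ∈ P → x ∧ y ∈ P
    ∧-∈ = proj₂ (proj₂ (proj₁ (proj₂ P))) _ _

    ∨-∈ : ∀ {x y} → x ∨ y ∈ P → x ∈ P ⊎ y ∈ P
    ∨-∈ = proj₂ (proj₂ (proj₂ P)) _ _

    𝟘∉ : 𝟘 ∉ P
    𝟘∉ 𝟘∈P = proj₁ (proj₂ (proj₂ P)) (λ x → ∈-upward 𝟘∈P (𝟘-least x))

    *-∉ : ∀ {x} → x ∈ P → x * ∈ P → ⊥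
    *-∉ {x} x∈P x*∈P = 𝟘∉ (subst (_∈ P) (∧-* x) (∧-∈ x∈P x*∈P))

  ⊑-refl : ∀ P → P ⊑ P
  ⊑-refl _ _ x∈P = x∈P

  ⊑-trans : ∀ P Q R → P ⊑ Q → Q ⊑ R → P ⊑ R
  ⊑-trans _ _ _ P⊑Q Q⊑R x x∈P = Q⊑R x (P⊑Q x x∈P)

  -- With x ∈ Q ∖ P, the element ∼(∼x)* lies in P (by ∼*-cover),
  -- so Q contains x ∧ ∼(∼x)* ≤ y ∨ y* for y ∈ R ∖ Q; but y, y* ∉ Q.
  no-three-chain : Regular 𝕃 → ∀ P Q R → P ⊏ Q → Q ⊏ R → ⊥
  no-three-chain regular P Q R (P⊑Q , x , x∈Q , x∉P) (Q⊑R , y , y∈R , y∉Q) =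
    [ y∉Q , (λ y*∈Q → *-∉ R y∈R (Q⊑R _ y*∈Q)) ]′
      (∨-∈ Q (∈-upward Q (∧-∈ Q x∈Q c∈Q) (regular-bound regular x y)))
    where
    c = ∼ ((∼ x) *)
    c∈Q : c ∈ Q
    c∈Q = P⊑Q c ([ ⊥-elim ∘ x∉P , id ]′
      (∨-∈ P (subst (_∈ P) (sym (∼*-cover x)) (𝟙∈ P))))

  module _ (em : ExcludedMiddle 0ℓ) where
    ⊑-or-⊈ : ∀ P Q → P ⊑ Q ⊎ P ⊈ Q
    ⊑-or-⊈ P Q with em {P ⊈ Q}
    ... | yes P⊈Q = inj₂ P⊈Q
    ... | no ¬P⊈Q = inj₁ (λ x x∈P → em⇒dne em (λ x∉Q → ¬P⊈Q (x , x∈P , x∉Q)))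

    comparable-unless-incomparable : ∀ P Q → ¬ Incomparable P Q → Comparable P Q
    comparable-unless-incomparable P Q ¬inc with ⊑-or-⊈ P Q | ⊑-or-⊈ Q P
    ... | inj₁ P⊑Q | _ = inj₁ P⊑Q
    ... | inj₂ _ | inj₁ Q⊑P = inj₂ Q⊑P
    ... | inj₂ P⊈Q | inj₂ Q⊈P = ⊥-elim (¬inc (P⊈Q , Q⊈P))

    -- g(P) = {x | ∼x ∉ P} is again a prime filter; primality needs excluded
    -- middle.
    gᴾ : PF → PF
    gᴾ P = g 𝕃 P , (𝟙∈g , ∈g-upward , ∧-∈g) , g-proper , ∨-∈g
      where
      𝟙∈g : ∼ 𝟙 ∉ P
      𝟙∈g = 𝟘∉ P ∘ subst (_∈ P) ∼𝟙
      ∈g-upward : ∀ x y → ∼ x ∉ P → x ≤ y → ∼ y ∉ P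
      ∈g-upward x y ∼x∉P x≤y ∼y∈P = ∼x∉P (∈-upward P ∼y∈P (∼-antitone x≤y))
      ∧-∈g : ∀ x y → ∼ x ∉ P → ∼ y ∉ P → ∼ (x ∧ y) ∉ P
      ∧-∈g x y ∼x∉P ∼y∉P ∼[x∧y]∈P =
        [ ∼x∉P , ∼y∉P ]′ (∨-∈ P (subst (_∈ P) (∼-∧ x y) ∼[x∧y]∈P))
      g-proper : ¬ (∀ x → ∼ x ∉ P)
      g-proper all = all 𝟘 (subst (_∈ P) (sym ∼𝟘) (𝟙∈ P))
      ∨-∈g : ∀ x y → ∼ (x ∨ y) ∉ P → ∼ x ∉ P ⊎ ∼ y ∉ P
      ∨-∈g x y ∼[x∨y]∉P with em {∼ x ∈ P}
      ... | yes ∼x∈P = inj₂ (λ ∼y∈P →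
              ∼[x∨y]∉P (subst (_∈ P) (sym (∼-∨ x y)) (∧-∈ P ∼x∈P ∼y∈P)))
      ... | no ∼x∉P = inj₁ ∼x∉P

    g-antitone : ∀ P Q → P ⊑ Q → gᴾ Q ⊑ gᴾ P
    g-antitone _ _ P⊑Q x ∼x∉Q ∼x∈P = ∼x∉Q (P⊑Q (∼ x) ∼x∈P)

    g-⊈ : ∀ P Q → P ⊈ Q → gᴾ Q ⊈ gᴾ P
    g-⊈ P Q (x , x∈P , x∉Q) =
      ∼ x , (λ ∼∼x∈Q → x∉Q (subst (_∈ Q) (∼-involutive x) ∼∼x∈Q))
          , (λ ∼∼x∉P → ∼∼x∉P (subst (_∈ P) (sym (∼-involutive x)) x∈P))

  module _ (regular : Regular 𝕃) (em : ExcludedMiddle 0ℓ) where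
    chain-collapse : ∀ P Q R → P ⊑ Q → Q ⊑ R → P ≐ Q ⊎ Q ≐ R
    chain-collapse P Q R P⊑Q Q⊑R with ⊑-or-⊈ em Q P | ⊑-or-⊈ em R Q
    ... | inj₁ Q⊑P | _ = inj₁ (P⊑Q , Q⊑P)
    ... | inj₂ _ | inj₁ R⊑Q = inj₂ (Q⊑R , R⊑Q)
    ... | inj₂ Q⊈P | inj₂ R⊈Q = ⊥-elim (no-three-chain regular P Q R (P⊑Q , Q⊈P) (Q⊑R , R⊈Q))

    two-coincide : ∀ P Q R → Comparable P Q → Comparable P R → Comparable Q R →
                   P ≐ Q ⊎ (P ≐ R ⊎ Q ≐ R)
    two-coincide P Q R (inj₁ P⊑Q) _ (inj₁ Q⊑R) =
      [ inj₁ , inj₂ ∘ inj₂ ]′ (chain-collapse P Q R P⊑Q Q⊑R)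
    two-coincide P Q R (inj₂ Q⊑P) _ (inj₂ R⊑Q) =
      [ inj₂ ∘ inj₂ ∘ swap , inj₁ ∘ swap ]′ (chain-collapse R Q P R⊑Q Q⊑P)
    two-coincide P Q R (inj₁ _) (inj₁ P⊑R) (inj₂ R⊑Q) =
      [ inj₂ ∘ inj₁ , inj₂ ∘ inj₂ ∘ swap ]′ (chain-collapse P R Q P⊑R R⊑Q)
    two-coincide P Q R (inj₁ P⊑Q) (inj₂ R⊑P) (inj₂ _) =
      [ inj₂ ∘ inj₁ ∘ swap , inj₁ ]′ (chain-collapse R P Q R⊑P P⊑Q)
    two-coincide P Q R (inj₂ Q⊑P) (inj₁ P⊑R) (inj₁ _) =
      [ inj₁ ∘ swap , inj₂ ∘ inj₁ ]′ (chain-collapse Q P R Q⊑P P⊑R)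
    two-coincide P Q R (inj₂ _) (inj₂ R⊑P) (inj₁ Q⊑R) =
      [ inj₂ ∘ inj₂ , inj₂ ∘ inj₁ ∘ swap ]′ (chain-collapse Q R P Q⊑R R⊑P)

  module _ (pft : PrimeFilterTheorem 𝕃) where
    -- If x* ∉ Q, some prime filter above Q contains x: separate the filter
    -- generated by Q ∪ {x} from the ideal {𝟘}.
    extend : ∀ Q x → x * ∉ Q → ∃ λ R → Q ⊑ R × x ∈ R
    extend Q x x*∉Q with pft F (_≡ 𝟘) F-filter 𝟘-ideal F∩𝟘=∅
      where
      F : Subset 𝕃
      F w = ∃ λ q → q ∈ Q × q ∧ x ≤ w
      F-filter : IsFilter 𝕃 F
      F-filter = (𝟙 , 𝟙∈ Q , 𝟙-greatest _)
        , (λ { _ _ (q , q∈Q , q∧x≤u) u≤w → q , q∈Q , ≤-trans q∧x≤u u≤w })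
        , (λ { _ _ (q , q∈Q , q∧x≤u) (r , r∈Q , r∧x≤w) → q ∧ r , ∧-∈ Q q∈Q r∈Q
             , ∧-greatest (≤-trans (∧-monoˡ x (∧-lowerˡ q r)) q∧x≤u)
                          (≤-trans (∧-monoˡ x (∧-lowerʳ q r)) r∧x≤w) })
      𝟘-ideal : IsIdeal 𝕃 (_≡ 𝟘)
      𝟘-ideal = refl
        , (λ { _ _ refl u≤𝟘 → ≤𝟘⇒≡𝟘 u≤𝟘 })
        , (λ { _ _ refl refl → 𝟘-bottom 𝟘 })
      F∩𝟘=∅ : ∀ w → F w → w ≡ 𝟘 → ⊥
      F∩𝟘=∅ _ (q , q∈Q , q∧x≤𝟘) refl =
        x*∉Q (∈-upward Q q∈Q (*-greatest (trans (∧-comm x q) (≤𝟘⇒≡𝟘 q∧x≤𝟘))))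
    ... | R , F⊆R , _ =
      R , (λ q q∈Q → F⊆R q (q , q∈Q , ∧-lowerˡ q x)) , F⊆R x (𝟙 , 𝟙∈ Q , ∧-lowerʳ 𝟙 x)

    -- Every element other than 𝟙 is avoided by some prime filter: separate
    -- the filter {𝟙} from the ideal ↓z.
    avoid : ∀ {z} → z ≢ 𝟙 → ∃ λ P → z ∉ P
    avoid {z} z≢𝟙 with pft (𝟙 ≤_) (_≤ z) 𝟙-filter ↓z-ideal 𝟙∉↓z
      where
      𝟙-filter : IsFilter 𝕃 (𝟙 ≤_)
      𝟙-filter = ≤-refl , (λ _ _ → ≤-trans) , (λ _ _ → ∧-greatest)
      ↓z-ideal : IsIdeal 𝕃 (_≤ z)
      ↓z-ideal = 𝟘-least z , (λ _ _ u≤z w≤u → ≤-trans w≤u u≤z) , (λ _ _ → ∨-least)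
      𝟙∉↓z : ∀ w → 𝟙 ≤ w → w ≤ z → ⊥
      𝟙∉↓z _ 𝟙≤w w≤z = z≢𝟙 (𝟙≤⇒≡𝟙 (≤-trans 𝟙≤w w≤z))
    ... | P , _ , P∩↓z=∅ = P , λ z∈P → P∩↓z=∅ z z∈P ≤-refl

  module _ (regular : Regular 𝕃) (em : ExcludedMiddle 0ℓ)
           (pft : PrimeFilterTheorem 𝕃) (stone : StoneL 𝕃) where
    -- Primes above a common prime P are comparable: if
    -- x ∈ Q₁ ∖ Q₂ and y ∈ Q₂ ∖ Q₁, then x* ∈ P is impossible (x ∈ Q₁), and
    -- x** ∈ P lets Q₂ extend to R ∋ x, giving the chain P ⊂ Q₂ ⊂ R.
    no-fork-above : ∀ P Q₁ Q₂ → P ⊑ Q₁ → P ⊑ Q₂ → ¬ Incomparable Q₁ Q₂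
    no-fork-above P Q₁ Q₂ P⊑Q₁ P⊑Q₂ ((x , x∈Q₁ , x∉Q₂) , (y , y∈Q₂ , y∉Q₁)) =
      [ (λ x*∈P → *-∉ Q₁ x∈Q₁ (P⊑Q₁ _ x*∈P)) , x**∉P ]′
        (∨-∈ P (subst (_∈ P) (sym (stone x)) (𝟙∈ P)))
      where
      x**∉P : (x *) * ∉ P
      x**∉P x**∈P with extend pft Q₂ x (λ x*∈Q₂ → *-∉ Q₂ x*∈Q₂ (P⊑Q₂ _ x**∈P))
      ... | R , Q₂⊑R , x∈R = no-three-chain regular P Q₂ R
        (P⊑Q₂ , y , y∈Q₂ , (λ y∈P → y∉Q₁ (P⊑Q₁ y y∈P)))
        (Q₂⊑R , x , x∈R , x∉Q₂)

    -- Dually, primes below a common prime M are comparable, as g maps them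
    -- to primes above g(M).
    no-fork-below : ∀ M Q₁ Q₂ → Q₁ ⊑ M → Q₂ ⊑ M → ¬ Incomparable Q₁ Q₂
    no-fork-below M Q₁ Q₂ Q₁⊑M Q₂⊑M (Q₁⊈Q₂ , Q₂⊈Q₁) =
      no-fork-above (gᴾ em M) (gᴾ em Q₁) (gᴾ em Q₂)
        (g-antitone em Q₁ M Q₁⊑M) (g-antitone em Q₂ M Q₂⊑M)
        (g-⊈ em Q₂ Q₁ Q₂⊈Q₁ , g-⊈ em Q₁ Q₂ Q₁⊈Q₂)

    -- Comparability is transitive: the mixed cases are forks above or below Q.
    comparable-trans : ∀ P Q R → Comparable P Q → Comparable Q R → Comparable P R
    comparable-trans P Q R (inj₁ P⊑Q) (inj₁ Q⊑R) = inj₁ (⊑-trans P Q R P⊑Q Q⊑R)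
    comparable-trans P Q R (inj₂ Q⊑P) (inj₂ R⊑Q) = inj₂ (⊑-trans R Q P R⊑Q Q⊑P)
    comparable-trans P Q R (inj₁ P⊑Q) (inj₂ R⊑Q) =
      comparable-unless-incomparable em P R (no-fork-below Q P R P⊑Q R⊑Q)
    comparable-trans P Q R (inj₂ Q⊑P) (inj₁ Q⊑R) =
      comparable-unless-incomparable em P R (no-fork-above Q P R Q⊑P Q⊑R)

    stone⇒two-chains : TwoChainUnion 𝕃
    stone⇒two-chains =
      Comparable , comparable-equivalence , (λ _ _ → id)
      , two-coincide regular em , (λ _ _ → inj₁)
      where
      comparable-equivalence : IsEquivalence Comparable
      comparable-equivalence = record
        { refl  = λ {P} → inj₁ (⊑-refl P)
        ; sym   = [ inj₂ , inj₁ ]′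
        ; trans = λ {P} {Q} {R} → comparable-trans P Q R }

  -- (b) ⇒ (c).  If Q ∈ ↑P ∩ A, every Q' ∈ ↑P lies in the block of Q and is
  -- comparable with it; either way ↑Q' meets A, so Q' ∉ A*.
  two-chains⇒stoneU : ExcludedMiddle (lsuc 0ℓ) → TwoChainUnion 𝕃 → StoneU 𝕃
  two-chains⇒stoneU em₁ (B , B-equivalence , B-chain , _ , ⊑⇒B) A A-upset P
    with em₁ {∃ λ Q → P ⊑ Q × A Q}
  ... | no ↑P∩A=∅ = inj₁ ↑P∩A=∅
  ... | yes (Q , P⊑Q , Q∈A) = inj₂ λ { (Q' , P⊑Q' , ↑Q'∩A=∅) →
      [ (λ Q⊑Q' → ↑Q'∩A=∅ (Q' , ⊑-refl Q' , A-upset Q Q' Q⊑Q' Q∈A))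
      , (λ Q'⊑Q → ↑Q'∩A=∅ (Q , Q'⊑Q , Q∈A)) ]′
      (B-chain Q Q' (B.trans (B.sym (⊑⇒B P Q P⊑Q)) (⊑⇒B P Q' P⊑Q'))) }
    where module B = IsEquivalence B-equivalence

  -- (c) ⇒ (a).  If x* ∨ x** ≠ 𝟙, take a prime P avoiding it.  For the upset
  -- A = {Q | x ∈ Q}: extending P by x shows P ∉ A*, and extending P by x*
  -- gives R ∈ ↑P ∩ A*, so P ∉ A**.
  stoneU⇒stone : ExcludedMiddle 0ℓ → PrimeFilterTheorem 𝕃 → StoneU 𝕃 → StoneL 𝕃
  stoneU⇒stone em pft stoneU x = em⇒dne em λ x*∨x**≢𝟙 →
    let P , x*∨x**∉P = avoid pft x*∨x**≢𝟙 in
    [ P∉A* P x*∨x**∉P , P∉A** P x*∨x**∉P ]′ (stoneU A A-upset P)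
    where
    A : PF → Set₁
    A Q = Lift (lsuc 0ℓ) (x ∈ Q)
    A-upset : IsUpset 𝕃 A
    A-upset _ _ Q⊑R (lift x∈Q) = lift (Q⊑R x x∈Q)
    P∉A* : ∀ P → x * ∨ (x *) * ∉ P → ¬ ¬ (∃ λ R → P ⊑ R × A R)
    P∉A* P x*∨x**∉P ↑P∩A=∅ =
      let R , P⊑R , x∈R = extend pft P x
            (λ x*∈P → x*∨x**∉P (∈-upward P x*∈P (∨-upperˡ _ _)))
      in ↑P∩A=∅ (R , P⊑R , lift x∈R)
    P∉A** : ∀ P → x * ∨ (x *) * ∉ P →
            ¬ ¬ (∃ λ R → P ⊑ R × ¬ (∃ λ S → R ⊑ S × A S))
    P∉A** P x*∨x**∉P ↑P∩A*=∅ =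
      let R , P⊑R , x*∈R = extend pft P (x *)
            (λ x**∈P → x*∨x**∉P (∈-upward P x**∈P (∨-upperʳ _ _)))
      in ↑P∩A*=∅ (R , P⊑R , λ { (S , R⊑S , lift x∈S) → *-∉ S x∈S (R⊑S _ x*∈R) })

theorem5p3 : (𝕃 : PKA) → Regular 𝕃 →
    ExcludedMiddle 0ℓ → ExcludedMiddle (lsuc 0ℓ) → PrimeFilterTheorem 𝕃 →
    (StoneL 𝕃 ⇔ TwoChainUnion 𝕃) × (TwoChainUnion 𝕃 ⇔ StoneU 𝕃)
theorem5p3 𝕃 regular em em₁ pft =
  mk⇔ a⇒b (c⇒a ∘ b⇒c) , mk⇔ b⇒c (a⇒b ∘ c⇒a)
  where
  a⇒b : StoneL 𝕃 → TwoChainUnion 𝕃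
  a⇒b = stone⇒two-chains 𝕃 regular em pft
  b⇒c : TwoChainUnion 𝕃 → StoneU 𝕃
  b⇒c = two-chains⇒stoneU 𝕃 em₁
  c⇒a : StoneU 𝕃 → StoneL 𝕃
  c⇒a = stoneU⇒stone 𝕃 em pft
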